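{- For each non-empty pair partition $\mathfrak{m}\in\mathcal{P}_k$, the $b$-Weingarten function satisfies, as formal power series in $N^{ -1}$, \[ \mathrm{Wg}^{(b)}(\mathfrak{m})=-\frac1N\sum_{i=1}^{2k-2}\omega^{(b)}(\mathfrak{m},(i~2k-1)\cdot\mathfrak{m})\,\mathrm{Wg}^{(b)}((i~2k-1)\cdot\mathfrak{m})+\frac1N\,\delta_{\{2k-1,2k\}\in\mathfrak{m}}\,\mathrm{Wg}^{(b)}(\mathfrak{m}^\downarrow). \]
   Context: $\mathcal{P}_k$ is the set of pair partitions of $\{1,\ldots,2k\}$ (partitions into two-element blocks; $\mathcal{P}_0=\{(\,)\}$), $\mathcal{P}_\bullet=\bigsqcup_k\mathcal{P}_k$, $\mathfrak{e}_k=\{\{1,2\},\ldots,\{2k-1,2k\}\}$. $S_{2k}$ acts by $\sigma\cdot\mathfrak{m}=\{\{\sigma(a),\sigma(b)\}:\{a,b\}\in\mathfrak{m}\}$. $\delta_{\{i,j\}\in\mathfrak{m}}$ is $1$ if $\{i,j\}\in\mathfrak{m}$, else $0$; if $\{2k-1,2k\}\in\mathfrak{m}$, $\mathfrak{m}^\downarrow\in\mathcal{P}_{k-1}$ deletes that block. Weight function $\omega^{(b)}:\mathcal{P}_\bullet\times\mathcal{P}_\bullet\to\{0,1,b\}$: $\omega^{(b)}(\mathfrak{m},\mathfrak{n})=0$ if $\mathfrak{m},\mathfrak{n}$ lie in different $\mathcal{P}_k$'s; $=1$ if both are empty; for $\mathfrak{m},\mathfrak{n}\in\mathcal{P}_k$,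 $k\ge1$: if no transposition $(i~j)\in S_{2k}$ has $(i~j)\cdot\mathfrak{m}=\mathfrak{n}$ it is $0$; otherwise take such $(i~j)$, form the multigraph $\Gamma(\mathfrak{m})$ on $\{1,\ldots,2k\}$ with an edge for each block of $\mathfrak{e}_k$ and an edge for each block of $\mathfrak{m}$ (a disjoint union of even cycles), assign charges $q(v)\in\{+,-\}$ so that the largest vertex of each cycle has charge $+$ and every edge joins vertices of opposite charge, and set $\omega^{(b)}(\mathfrak{m},\mathfrak{n})=1$ if $q(i)=q(j)$ and $=b$ if $q(i)\ne q(j)$ (independent of the choice of $(i~j)$). The $b$-Weingarten graph $\mathcal{G}^{(b)}$ has vertex set $\mathcal{P}_\bullet$ and, for $\mathfrak{m}\in\mathcal{P}_k$: type $A$ edges $\mathfrak{m}\to(i~2k-1)\cdot\mathfrak{m}$ for each $1\le i\le 2k-2$, of weight $\omega^{(b)}(\mathfrak{m},(i~2k-1)\cdot\mathfrak{m})$; and a type $B$ edge $\mathfrak{m}\to\mathfrak{m}^\downarrow$ of weight $1$ when $\{2k-1,2k\}\in\mathfrak{m}$. The $b$-Weingarten function is $\mathrm{Wg}^{(b)}(\mathfrak{m})=\sum_{\bm\rho}(-1/N)^{\ell_A(\bm\rho)}(1/N)^{\ell_B(\bm\rho)}w(\bm\rho)\in\mathbb{R}[b][[N^{ -1}]]$, summed over directed paths $\bm\rho$ in $\mathcal{G}^{(b)}$ from $\mathfrak{m}$ to the empty pair partition, where $\ell_A,\ell_B$ count edges of each type and $w(\bm\rho)$ is the product of the edge weights.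 -}

module Defs where

open import Data.Nat as ℕ using (ℕ; zero; suc; _<ᵇ_; _≡ᵇ_)
open import Data.Nat.Properties as ℕP using ()
open import Data.Integer as ℤ using (ℤ; 0ℤ; 1ℤ; -_)
open import Data.Fin as Fin using (Fin; toℕ; inject₁; fromℕ; lower₁)
open import Data.Fin.Properties as FinP using (toℕ-lower₁; toℕ-inject₁; toℕ-fromℕ; toℕ-injective; _≟_)
import Data.Fin.Permutation.Components as PC
import Data.Bool as B
open import Data.Bool using (Bool; true; false; if_then_else_; not; _∧_; _∨_)
open import Data.List as List using (List; []; _∷_; _++_; map; concatMap; allFin; foldr; filter; cartesianProduct)
open import Data.Bool.ListAction using (and)
open import Relation.Nullary.Decidable using (T?)
open import Data.Maybe using (Maybe; just; nothing)
open import Data.Product using (Σ; _×_; _,_; proj₁; proj₂)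
open import Relation.Binary.PropositionalEquality
open import Relation.Nullary using (¬_; Dec; yes; no; does)
open import Relation.Nullary.Negation using (contradiction)
open import Function using (_∘_)

-- Points 1,…,2k of the paper are the elements 0,…,2k-1 of Fin (double k)
-- (paper's point p ↔ Fin element p-1).  A pair partition is encoded by
-- its "partner" map: a fixed-point-free involution of Fin (double k);
-- the block containing x is {x , partner x}.

double : ℕ → ℕ
double zero    = zero
double (suc k) = suc (suc (double k))

IsPairing : {n : ℕ} → (Fin n → Fin n) → Set
IsPairing {n} p = ((x : Fin n) → p (p x) ≡ x) × ((x : Fin n) → p x ≢ x)

PP : ℕ → Set
PP k = Σ (Fin (double k) → Fin (double k)) IsPairing

partner : {k : ℕ} → PP k → Fin (double k) → Fin (double k)
partner = proj₁

emptyPP : PP 0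
emptyPP = (λ ()) , (λ ()) , (λ ())

-- Action of a transposition (i j) ∈ S_{2k}:  (σ·𝔪)(x) = σ (𝔪 (σ⁻¹ x)),
-- i.e. blocks {a,b} ↦ {σ a, σ b}.  σ = PC.transpose i j, σ⁻¹ = PC.transpose j i.

actT : {k : ℕ} → Fin (double k) → Fin (double k) → PP k → PP k
actT i j (p , inv , fpf) = q , invq , fpfq
  where
  σ σ⁻¹ : _ → _
  σ   = PC.transpose i j
  σ⁻¹ = PC.transpose j i
  q : _ → _
  q x = σ (p (σ⁻¹ x))
  invq : ∀ x → q (q x) ≡ x
  invq x = trans (cong (σ ∘ p) (PC.transpose-inverse j i))
                 (trans (cong σ (inv (σ⁻¹ x))) (PC.transpose-inverse i j))
  fpfq : ∀ x → q x ≢ x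
  fpfq x e = fpf (σ⁻¹ x) (trans (sym (PC.transpose-inverse j i)) (cong σ⁻¹ e))

-- The last two points 2k-1, 2k of {1,…,2k} (k = suc k'), as elements of Fin.

pt₂ₖ₋₁ : (k : ℕ) → Fin (double (suc k))
pt₂ₖ₋₁ k = inject₁ (fromℕ (double k))

pt₂ₖ : (k : ℕ) → Fin (double (suc k))
pt₂ₖ k = fromℕ (suc (double k))

inj₂ : {n : ℕ} → Fin n → Fin (suc (suc n))
inj₂ = inject₁ ∘ inject₁

actA : {k : ℕ} → PP (suc k) → Fin (double k) → PP (suc k)
actA {k} m i = actT (inj₂ i) (pt₂ₖ₋₁ k) m

LastBlock : {k : ℕ} → PP (suc k) → Set
LastBlock {k} m = partner m (pt₂ₖ₋₁ k) ≡ pt₂ₖ k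

lastBlock? : {k : ℕ} (m : PP (suc k)) → Dec (LastBlock m)
lastBlock? {k} m = partner m (pt₂ₖ₋₁ k) ≟ pt₂ₖ k

private
  toℕ-inj₂ : {n : ℕ} (x : Fin n) → toℕ (inj₂ x) ≡ toℕ x
  toℕ-inj₂ x = trans (toℕ-inject₁ (inject₁ x)) (toℕ-inject₁ x)

  inj₂-injective : {n : ℕ} {x y : Fin n} → inj₂ x ≡ inj₂ y → x ≡ y
  inj₂-injective {x = x} {y} e =
    toℕ-injective (trans (sym (toℕ-inj₂ x)) (trans (cong toℕ e) (toℕ-inj₂ y)))

  <⇒≢ : {a b : ℕ} → a ℕ.< b → a ≢ b
  <⇒≢ a<b refl = ℕP.<-irrefl refl a<b

  lower₂ : {n : ℕ} (y : Fin (suc (suc n))) → suc n ≢ toℕ y → n ≢ toℕ y → Fin n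
  lower₂ {n} y p1 p2 = lower₁ (lower₁ y p1) (λ e → p2 (trans e (toℕ-lower₁ y p1)))

  toℕ-lower₂ : {n : ℕ} (y : Fin (suc (suc n))) (p1 : suc n ≢ toℕ y) (p2 : n ≢ toℕ y)
             → toℕ (lower₂ y p1 p2) ≡ toℕ y
  toℕ-lower₂ y p1 p2 = trans (toℕ-lower₁ (lower₁ y p1) _) (toℕ-lower₁ y p1)

  inj₂-lower₂ : {n : ℕ} (y : Fin (suc (suc n))) (p1 : suc n ≢ toℕ y) (p2 : n ≢ toℕ y)
              → inj₂ (lower₂ y p1 p2) ≡ y
  inj₂-lower₂ y p1 p2 = toℕ-injective (trans (toℕ-inj₂ _) (toℕ-lower₂ y p1 p2))

module _ {k : ℕ} (m : PP (suc k)) (h : LastBlock m) where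
  private
    p = partner m
    inv = proj₁ (proj₂ m)
    fpf = proj₂ (proj₂ m)
    a = pt₂ₖ₋₁ k
    c = pt₂ₖ k
    pc : p c ≡ a
    pc = trans (cong p (sym h)) (inv a)
    toℕa : toℕ a ≡ double k
    toℕa = trans (toℕ-inject₁ (fromℕ (double k))) (toℕ-fromℕ (double k))
    toℕc : toℕ c ≡ suc (double k)
    toℕc = toℕ-fromℕ (suc (double k))
    x<n : (x : Fin (double k)) → toℕ (inj₂ x) ℕ.< double k
    x<n x = subst (ℕ._< double k) (sym (toℕ-inj₂ x)) (FinP.toℕ<n x)
    ne1 : (x : Fin (double k)) → suc (double k) ≢ toℕ (p (inj₂ x))
    ne1 x e = <⇒≢ (x<n x) (trans (cong toℕ eq) toℕa)
      where
      eq : inj₂ x ≡ a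
      eq = trans (sym (inv (inj₂ x)))
                 (trans (cong p (toℕ-injective (trans (sym e) (sym toℕc)))) pc)
    ne2 : (x : Fin (double k)) → double k ≢ toℕ (p (inj₂ x))
    ne2 x e = <⇒≢ (ℕP.m<n⇒m<1+n (x<n x)) (trans (cong toℕ eq) toℕc)
      where
      eq : inj₂ x ≡ c
      eq = trans (sym (inv (inj₂ x)))
                 (trans (cong p (toℕ-injective (trans (sym e) (sym toℕa)))) h)
    q : Fin (double k) → Fin (double k)
    q x = lower₂ (p (inj₂ x)) (ne1 x) (ne2 x)
    inj-q : ∀ x → inj₂ (q x) ≡ p (inj₂ x)
    inj-q x = inj₂-lower₂ _ (ne1 x) (ne2 x)

  down : PP k
  down = q , (λ x → inj₂-injective (trans (inj-q (q x))
                                    (trans (cong p (inj-q x)) (inv (inj₂ x)))))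
           , (λ x e → fpf (inj₂ x) (trans (sym (inj-q x)) (cong inj₂ e)))

-- Charges.  Γ(𝔪) has an edge for every block of 𝔢_k = {{1,2},…} and of 𝔪.
-- Walking from v alternately along an 𝔢_k-edge and an 𝔪-edge traverses
-- the cycle of v; q(v) = + iff the (first) position of the largest vertex
-- of the cycle along this walk is even.

eK : (k : ℕ) → Fin (double k) → Fin (double k)
eK (suc k) Fin.zero = Fin.suc Fin.zero
eK (suc k) (Fin.suc Fin.zero) = Fin.zero
eK (suc k) (Fin.suc (Fin.suc x)) = Fin.suc (Fin.suc (eK k x))

walk : {k : ℕ} → PP k → ℕ → Fin (double k) → Bool → List (Fin (double k))
walk m zero v _ = []
walk {k} m (suc r) v useE =
  v ∷ walk m r (if useE then eK k v else partner m v) (not useE)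

maxList : List ℕ → ℕ
maxList = foldr ℕ._⊔_ 0

firstIndex : ℕ → List ℕ → ℕ
firstIndex t [] = 0
firstIndex t (x ∷ xs) = if x ≡ᵇ t then 0 else suc (firstIndex t xs)

isEven : ℕ → Bool
isEven zero = true
isEven (suc n) = not (isEven n)

-- q(v) = + is encoded as true, q(v) = − as false
charge : {k : ℕ} → PP k → Fin (double k) → Bool
charge {k} m v = isEven (firstIndex (maxList cyc) cyc)
  where
  cyc : List ℕ
  cyc = map toℕ (walk m (double k) v true)   -- 2k ≥ cycle length

-- The weight ω^{(b)} on 𝒫_k × 𝒫_k (different k's never occur below).

data Weight : Set where
  w0 w1 wb : Weight

samePP : {k : ℕ} → PP k → PP k → Bool
samePP {k} m n = and (map (λ x → does (partner m x ≟ partner n x)) (allFin (double k)))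

transpositions : (k : ℕ) → List (Fin (double k) × Fin (double k))
transpositions k =
  filter (λ ij → toℕ (proj₁ ij) ℕ.<? toℕ (proj₂ ij))
         (cartesianProduct (allFin (double k)) (allFin (double k)))

ω : {k : ℕ} → PP k → PP k → Weight
ω {zero}  m n = w1
ω {suc k} m n with filter (λ ij → T? (samePP (actT (proj₁ ij) (proj₂ ij) m) n))
                          (transpositions (suc k))
... | [] = w0
... | (i , j) ∷ _ = if does (charge m i B.≟ charge m j) then w1 else wb

-- Elements of ℤ[b][[N⁻¹]] (the series here have integer coefficients;
-- ℤ[b][[N⁻¹]] ⊆ ℝ[b][[N⁻¹]]), represented by their coefficient arrays:
-- f n j = coefficient of N⁻ⁿ bʲ.

Series : Set
Series = ℕ → ℕ → ℤ

infix 4 _≈ˢ_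
_≈ˢ_ : Series → Series → Set
f ≈ˢ g = (n j : ℕ) → f n j ≡ g n j

0ˢ : Series
0ˢ _ _ = 0ℤ

infixl 6 _+ˢ_
_+ˢ_ : Series → Series → Series
(f +ˢ g) n j = f n j ℤ.+ g n j

-ˢ_ : Series → Series
(-ˢ f) n j = - (f n j)

N⁻¹·_ : Series → Series
(N⁻¹· f) zero    j = 0ℤ
(N⁻¹· f) (suc n) j = f n j

b·_ : Series → Series
(b· f) n zero    = 0ℤ
(b· f) n (suc j) = f n j

_·ˢ_ : Weight → Series → Series
w0 ·ˢ f = 0ˢ
w1 ·ˢ f = f
wb ·ˢ f = b· f

Σˢ : (n : ℕ) → (Fin n → Series) → Series
Σˢ n F = foldr _+ˢ_ 0ˢ (map F (allFin n))

-- The b-Weingarten graph 𝒢^{(b)} and directed paths to the empty pair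
-- partition.  For 𝔪 ∈ 𝒫_{k+1} the type A edges are indexed by
-- i ∈ Fin (2k) ≅ {1,…,2(k+1)-2}; the type B edge exists when {2k+1,2k+2} ∈ 𝔪.
-- (𝒫_0 has the single element ( ), which has no outgoing edges.)

data Path : {k : ℕ} → PP k → Set where
  done  : (m : PP 0) → Path m
  edgeA : {k : ℕ} (m : PP (suc k)) (i : Fin (double k)) → Path (actA m i) → Path m
  edgeB : {k : ℕ} (m : PP (suc k)) (h : LastBlock m) → Path (down m h) → Path m

paths : {k : ℕ} (m : PP k) → ℕ → List (Path m)
paths {zero}  m zero    = done m ∷ []
paths {zero}  m (suc n) = []
paths {suc k} m zero    = []
paths {suc k} m (suc n) =
  concatMap (λ i → map (edgeA m i) (paths (actA m i) n)) (allFin (double k))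
  ++ viaB (lastBlock? m)
  where
  viaB : Dec (LastBlock m) → List (Path m)
  viaB (yes h) = map (edgeB m h) (paths (down m h) n)
  viaB (no _)  = []

ℓA : {k : ℕ} {m : PP k} → Path m → ℕ
ℓA (done _)       = 0
ℓA (edgeA _ _ ρ)  = suc (ℓA ρ)
ℓA (edgeB _ _ ρ)  = ℓA ρ

-- w(ρ) = product of the edge weights: nothing = 0, just j = bʲ
w : {k : ℕ} {m : PP k} → Path m → Maybe ℕ
w (done _) = just 0
w (edgeA m i ρ) with ω m (actA m i) | w ρ
... | w0 | _        = nothing
... | _  | nothing  = nothing
... | w1 | just j   = just j
... | wb | just j   = just (suc j)
w (edgeB _ _ ρ) = w ρ

sign : ℕ → ℤ
sign zero    = 1ℤ
sign (suc n) = - sign n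

coeffᵇ : {k : ℕ} {m : PP k} → Path m → ℕ → ℤ
coeffᵇ ρ j with w ρ
... | nothing = 0ℤ
... | just j′ = if j′ ≡ᵇ j then sign (ℓA ρ) else 0ℤ

-- Wg^{(b)}(𝔪) = Σ_ρ (-1/N)^{ℓ_A(ρ)} (1/N)^{ℓ_B(ρ)} w(ρ); its coefficient of
-- N⁻ⁿ bʲ collects the paths with ℓ_A + ℓ_B = n.
Wg : {k : ℕ} → PP k → Series
Wg m n j = foldr ℤ._+_ 0ℤ (map (λ ρ → coeffᵇ ρ j) (paths m n))

δWg↓ : {k : ℕ} → PP (suc k) → Series
δWg↓ m with lastBlock? m
... | yes h = Wg (down m h)
... | no _  = 0ˢ

{-# OPTIONS --safe #-}
module Submission where

-- A path from 𝔪 ∈ 𝒫_{k+1} to ( ) with n + 1 edges is a first edge followed by a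
-- path with n edges.  A first type A edge to (i 2k-1)·𝔪 multiplies the weight of
-- the remaining path by ω(𝔪, (i 2k-1)·𝔪) and flips its sign; a first type B edge
-- to 𝔪↓ changes neither.  Summing over the paths of each kind gives the recursion
-- coefficient by coefficient, the shift n ↦ n + 1 being the factor 1/N.

open import Defs
open import Data.Nat using (ℕ; zero; suc; _≡ᵇ_)
open import Data.Integer using (ℤ; 0ℤ; _+_; -_)
open import Data.Integer.Properties using (+-identityˡ; +-assoc; neg-distrib-+)
open import Data.Bool using (Bool; true; false; if_then_else_)
open import Data.Fin using (Fin)
open import Data.List using (List; []; _∷_; _++_; map; foldr; concatMap; allFin)
open import Data.List.Properties using (map-∘; map-cong)
open import Data.Maybe using (Maybe; just; nothing)
open import Function using (_∘_)
open import Relation.Nullary using (yes; no)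
open import Relation.Binary.PropositionalEquality
open ≡-Reasoning

sumMap : {A : Set} → (A → ℤ) → List A → ℤ
sumMap f xs = foldr _+_ 0ℤ (map f xs)

sumMap-++ : {A : Set} (f : A → ℤ) (xs ys : List A) → sumMap f (xs ++ ys) ≡ sumMap f xs + sumMap f ys
sumMap-++ f []       ys = sym (+-identityˡ (sumMap f ys))
sumMap-++ f (x ∷ xs) ys = begin
  f x + sumMap f (xs ++ ys)            ≡⟨ cong (f x +_) (sumMap-++ f xs ys) ⟩
  f x + (sumMap f xs + sumMap f ys)    ≡⟨ sym (+-assoc (f x) _ _) ⟩
  f x + sumMap f xs + sumMap f ys      ∎

sumMap-cong : {A : Set} {f g : A → ℤ} → (∀ x → f x ≡ g x) → (xs : List A) → sumMap f xs ≡ sumMap g xs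
sumMap-cong f≗g xs = cong (foldr _+_ 0ℤ) (map-cong f≗g xs)

sumMap-map : {A B : Set} (f : B → ℤ) (g : A → B) (xs : List A) → sumMap f (map g xs) ≡ sumMap (f ∘ g) xs
sumMap-map f g xs = cong (foldr _+_ 0ℤ) (sym (map-∘ xs))

sumMap-concatMap : {A B : Set} (f : B → ℤ) (g : A → List B) (xs : List A)
                 → sumMap f (concatMap g xs) ≡ sumMap (sumMap f ∘ g) xs
sumMap-concatMap f g []       = refl
sumMap-concatMap f g (x ∷ xs) = begin
  sumMap f (g x ++ concatMap g xs)            ≡⟨ sumMap-++ f (g x) (concatMap g xs) ⟩
  sumMap f (g x) + sumMap f (concatMap g xs)  ≡⟨ cong (sumMap f (g x) +_) (sumMap-concatMap f g xs) ⟩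
  sumMap f (g x) + sumMap (sumMap f ∘ g) xs   ∎

neg-sumMap : {A : Set} (f : A → ℤ) (xs : List A) → - sumMap f xs ≡ sumMap (-_ ∘ f) xs
neg-sumMap f []       = refl
neg-sumMap f (x ∷ xs) = trans (neg-distrib-+ (f x) (sumMap f xs)) (cong (- f x +_) (neg-sumMap f xs))

sumMap-zero : {A : Set} (xs : List A) → sumMap (λ _ → 0ℤ) xs ≡ 0ℤ
sumMap-zero []       = refl
sumMap-zero (x ∷ xs) = trans (+-identityˡ _) (sumMap-zero xs)

infixr 7 _·ᵇ_
_·ᵇ_ : Weight → (ℕ → ℤ) → ℕ → ℤ
(w0 ·ᵇ g) j       = 0ℤ
(w1 ·ᵇ g) j       = g j
(wb ·ᵇ g) zero    = 0ℤ
(wb ·ᵇ g) (suc j) = g j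

·ˢ-coefficient : (W : Weight) (F : Series) (n j : ℕ) → (W ·ˢ F) n j ≡ (W ·ᵇ F n) j
·ˢ-coefficient w0 F n j       = refl
·ˢ-coefficient w1 F n j       = refl
·ˢ-coefficient wb F n zero    = refl
·ˢ-coefficient wb F n (suc j) = refl

sumMap-·ᵇ : {A : Set} (W : Weight) (g : A → ℕ → ℤ) (xs : List A) (j : ℕ)
          → sumMap (λ x → (W ·ᵇ g x) j) xs ≡ (W ·ᵇ (λ j′ → sumMap (λ x → g x j′) xs)) j
sumMap-·ᵇ w0 g xs j       = sumMap-zero xs
sumMap-·ᵇ w1 g xs j       = refl
sumMap-·ᵇ wb g xs zero    = sumMap-zero xs
sumMap-·ᵇ wb g xs (suc j) = refl

Σˢ-coefficient : (k : ℕ) (F : Fin k → Series) (n j : ℕ) → Σˢ k F n j ≡ sumMap (λ i → F i n j) (allFin k)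
Σˢ-coefficient k F n j = go (allFin k)
  where
  go : (is : List (Fin k)) → foldr _+ˢ_ 0ˢ (map F is) n j ≡ sumMap (λ i → F i n j) is
  go []       = refl
  go (i ∷ is) = cong (F i n j +_) (go is)

neg-if : (c : Bool) (x : ℤ) → (if c then - x else 0ℤ) ≡ - (if c then x else 0ℤ)
neg-if true  x = refl
neg-if false x = refl

signedMonomial : Maybe ℕ → ℕ → ℕ → ℤ
signedMonomial nothing   ℓ j = 0ℤ
signedMonomial (just j′) ℓ j = if j′ ≡ᵇ j then sign ℓ else 0ℤ

-- Abstracting w ρ in a goal about a path into down m h exhausts the type
-- checker, so edgeB is handled through this lemma for arbitrary paths.
coeffᵇ-monomial : {k : ℕ} {m : PP k} (ρ : Path m) (j : ℕ) → coeffᵇ ρ j ≡ signedMonomial (w ρ) (ℓA ρ) j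
coeffᵇ-monomial ρ j with w ρ
... | nothing = refl
... | just _  = refl

module _ {k : ℕ} (m : PP (suc k)) where

  neighbourTerm : Fin (double k) → Series
  neighbourTerm i = ω m (actA m i) ·ˢ Wg (actA m i)

  coeffᵇ-edgeA : (i : Fin (double k)) (ρ : Path (actA m i)) (j : ℕ)
               → coeffᵇ (edgeA m i ρ) j ≡ - (ω m (actA m i) ·ᵇ coeffᵇ ρ) j
  coeffᵇ-edgeA i ρ j with ω m (actA m i) | w ρ
  coeffᵇ-edgeA i ρ j       | w0 | _       = refl
  coeffᵇ-edgeA i ρ j       | w1 | nothing = refl
  coeffᵇ-edgeA i ρ j       | w1 | just j′ = neg-if (j′ ≡ᵇ j) (sign (ℓA ρ))
  coeffᵇ-edgeA i ρ zero    | wb | nothing = refl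
  coeffᵇ-edgeA i ρ zero    | wb | just _  = refl
  coeffᵇ-edgeA i ρ (suc j) | wb | nothing = refl
  coeffᵇ-edgeA i ρ (suc j) | wb | just j′ = neg-if (j′ ≡ᵇ j) (sign (ℓA ρ))

  coeffᵇ-edgeB : (h : LastBlock m) (ρ : Path (down m h)) (j : ℕ) → coeffᵇ (edgeB m h ρ) j ≡ coeffᵇ ρ j
  coeffᵇ-edgeB h ρ j = trans (coeffᵇ-monomial (edgeB m h ρ) j) (sym (coeffᵇ-monomial ρ j))

  pathsViaA : ℕ → List (Path m)
  pathsViaA n = concatMap (λ i → map (edgeA m i) (paths (actA m i) n)) (allFin (double k))

  pathsViaB : ℕ → List (Path m)
  pathsViaB n with lastBlock? m
  ... | yes h = map (edgeB m h) (paths (down m h) n)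
  ... | no _  = []

  paths-suc : (n : ℕ) → paths m (suc n) ≡ pathsViaA n ++ pathsViaB n
  paths-suc n with lastBlock? m
  ... | yes _ = refl
  ... | no _  = refl

  sumMap-edgeA : (i : Fin (double k)) (n j : ℕ)
    → sumMap (λ ρ → coeffᵇ ρ j) (map (edgeA m i) (paths (actA m i) n)) ≡ - neighbourTerm i n j
  sumMap-edgeA i n j = begin
    sumMap (λ ρ → coeffᵇ ρ j) (map (edgeA m i) ps)
      ≡⟨ sumMap-map _ (edgeA m i) ps ⟩
    sumMap (λ ρ → coeffᵇ (edgeA m i ρ) j) ps
      ≡⟨ sumMap-cong (λ ρ → coeffᵇ-edgeA i ρ j) ps ⟩
    sumMap (λ ρ → - (W ·ᵇ coeffᵇ ρ) j) ps
      ≡⟨ sym (neg-sumMap _ ps) ⟩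
    - sumMap (λ ρ → (W ·ᵇ coeffᵇ ρ) j) ps
      ≡⟨ cong -_ (sumMap-·ᵇ W coeffᵇ ps j) ⟩
    - (W ·ᵇ Wg (actA m i) n) j
      ≡⟨ cong -_ (sym (·ˢ-coefficient W (Wg (actA m i)) n j)) ⟩
    - neighbourTerm i n j
      ∎
    where
    ps = paths (actA m i) n
    W  = ω m (actA m i)

  sumMap-pathsViaA : (n j : ℕ) → sumMap (λ ρ → coeffᵇ ρ j) (pathsViaA n) ≡ - Σˢ (double k) neighbourTerm n j
  sumMap-pathsViaA n j = begin
    sumMap (λ ρ → coeffᵇ ρ j) (pathsViaA n)
      ≡⟨ sumMap-concatMap _ _ is ⟩
    sumMap (λ i → sumMap (λ ρ → coeffᵇ ρ j) (map (edgeA m i) (paths (actA m i) n))) is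
      ≡⟨ sumMap-cong (λ i → sumMap-edgeA i n j) is ⟩
    sumMap (λ i → - neighbourTerm i n j) is
      ≡⟨ sym (neg-sumMap _ is) ⟩
    - sumMap (λ i → neighbourTerm i n j) is
      ≡⟨ cong -_ (sym (Σˢ-coefficient (double k) neighbourTerm n j)) ⟩
    - Σˢ (double k) neighbourTerm n j
      ∎
    where is = allFin (double k)

  sumMap-pathsViaB : (n j : ℕ) → sumMap (λ ρ → coeffᵇ ρ j) (pathsViaB n) ≡ δWg↓ m n j
  sumMap-pathsViaB n j with lastBlock? m
  ... | no _  = refl
  ... | yes h = trans (sumMap-map _ (edgeB m h) ps) (sumMap-cong (λ ρ → coeffᵇ-edgeB h ρ j) ps)
    where ps = paths (down m h) n

proposition4p6 : (k : ℕ) (m : PP (suc k))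
    → Wg m ≈ˢ (-ˢ (N⁻¹· Σˢ (double k) (λ i → ω m (actA m i) ·ˢ Wg (actA m i))))
    +ˢ (N⁻¹· δWg↓ m)
proposition4p6 k m zero    j = refl
proposition4p6 k m (suc n) j = begin
  sumMap coeff (paths m (suc n))
    ≡⟨ cong (sumMap coeff) (paths-suc m n) ⟩
  sumMap coeff (pathsViaA m n ++ pathsViaB m n)
    ≡⟨ sumMap-++ coeff (pathsViaA m n) (pathsViaB m n) ⟩
  sumMap coeff (pathsViaA m n) + sumMap coeff (pathsViaB m n)
    ≡⟨ cong₂ _+_ (sumMap-pathsViaA m n j) (sumMap-pathsViaB m n j) ⟩
  - Σˢ (double k) (neighbourTerm m) n j + δWg↓ m n j
    ∎
  where
  coeff : Path m → ℤ
  coeff ρ = coeffᵇ ρ j
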